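{- For all positive integers $n,k$ with $2k<n$, $$\mathrm{Det}(K(n,k))\leq \mathrm{Det}(K(n+1,k)) \leq \mathrm{Det}(K(n,k))+1.$$
   Context: For positive integers $n,k$, the Kneser graph $K(n,k)$ has as vertices the $k$-element subsets of $[n]=\{1,\ldots,n\}$, two vertices being adjacent iff the subsets are disjoint. For a graph $G=(V,E)$, the determining number $\mathrm{Det}(G)$ is the minimum cardinality of a set $S\subseteq V$ such that the only automorphism of $G$ fixing every vertex of $S$ is the identity (such $S$ is a determining set). Known fact: for $n>2k$, a family $\{V_1,\ldots,V_r\}$ of $k$-subsets of $[n]$ is a determining set of $K(n,k)$ iff there is no pair of distinct $a,b\in[n]$ such that for every $i$ either $\{a,b\}\subseteq V_i$ or $\{a,b\}\subseteq [n]\setminus V_i$. -}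

module Defs where

open import Level using (0ℓ)
open import Data.Nat using (ℕ; _≤_)
open import Data.Fin using (Fin)
open import Data.Fin.Subset using (Subset; _∈_; ∣_∣)
open import Data.Product using (Σ; _×_)
open import Data.Empty using (⊥)
open import Data.List using (List; length)
open import Data.List.Membership.Propositional as L using ()
open import Relation.Binary.PropositionalEquality using (_≡_)
open import Function.Bundles using (_⤖_; Bijection; _⇔_)

record Graph : Set₁ where
  field
    V   : Set
    Adj : V → V → Set
open Graph public

KVertex : ℕ → ℕ → Set
KVertex n k = Σ (Subset n) (λ s → ∣ s ∣ ≡ k)

Disjoint : ∀ {n} → Subset n → Subset n → Set
Disjoint {n} s t = (i : Fin n) → i ∈ s → i ∈ t → ⊥

Kneser : ℕ → ℕ → Graph
Kneser n k = record
  { V   = KVertex n k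
  ; Adj = λ u v → Disjoint (Data.Product.proj₁ u) (Data.Product.proj₁ v)
  }

record Automorphism (G : Graph) : Set where
  field
    bij      : V G ⤖ V G
    preserve : ∀ u v → Adj G u v ⇔ Adj G (Bijection.to bij u) (Bijection.to bij v)

autFun : ∀ {G} → Automorphism G → V G → V G
autFun f = Bijection.to (Automorphism.bij f)

IsDetermining : (G : Graph) → List (V G) → Set
IsDetermining G S =
  (f : Automorphism G) → (∀ v → v L.∈ S → autFun f v ≡ v) → ∀ v → autFun f v ≡ v

-- d is the determining number of G: minimum cardinality of a determining set.
-- (Sets are represented as lists; duplicates only increase length, so the
-- minimum over lists equals the minimum over sets.)
IsDetNumber : Graph → ℕ → Set
IsDetNumber G d =
  Σ (List (V G)) (λ S → IsDetermining G S × length S ≡ d)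
  × ((S : List (V G)) → IsDetermining G S → d ≤ length S)

-- For n > 2k every automorphism of K(n,k) is induced by a permutation of [n], so a family of
-- k-sets is determining iff it separates points (no two points lie in exactly the same members).
-- The automorphism statement goes by induction on k: two k-sets meet in k - 1 points iff a
-- condition on common neighbourhoods holds, so an automorphism F of K(n,k) induces one of K(n,k-1)
-- by A ∩ B ↦ F A ∩ F B, and a permutation inducing the latter also induces F.
-- A separating family for [n] together with one k-set made of the new point and k - 1 points of a
-- member separates [n+1]. Conversely, deleting the new point from a separating family for [n+1]
-- leaves sets of size k or k - 1, and each (k - 1)-set V can be enlarged by a point outside V
-- without losing separation: the points outside V that agree off V with a point of V are
-- determined by that point, and there are more than |V| points outside V.
-- The new point of [n+1] is `zero : Fin (suc n)`.

module Submission where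

open import Defs
open import Data.Bool using (true)
import Data.Bool.Properties as Boolₚ
open import Data.Empty using (⊥-elim)
open import Data.Fin using (Fin; zero; suc)
open import Data.Fin.Permutation as Perm using (Permutation; _⟨$⟩ʳ_; _⟨$⟩ˡ_; inverseˡ; inverseʳ)
import Data.Fin.Properties as Finₚ
open import Data.Fin.Subset
open import Data.Fin.Subset.Properties
open import Data.List using (List; []; _∷_; map; length; _++_; [_])
open import Data.List.Properties using (length-map; ++-assoc)
import Data.List.Membership.Propositional as Listₘ
open import Data.List.Relation.Unary.All as All using (All; []; _∷_)
import Data.List.Relation.Unary.All.Properties as Allₚ
open import Data.Nat using (ℕ; zero; suc; _+_; _*_; _∸_; _≤_; _<_; z≤n; s≤s)
import Data.Nat.Properties as ℕₚ
open import Data.Product using (∃; ∃₂; _×_; _,_; proj₁; proj₂)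
open import Data.Sum using (_⊎_; inj₁; inj₂; [_,_]′; map₂)
open import Data.Vec using ([]; _∷_; here; there; lookup; tabulate)
import Data.Vec.Properties as Vecₚ
open import Function using (_∘_)
open import Function.Bundles using (Bijection; Equivalence; mk⤖; mk⇔)
open import Relation.Nullary using (Dec; ¬_; yes; no; ¬?; _×-dec_; decidable-stable)
open import Relation.Binary.PropositionalEquality hiding ([_])

-- Finite subsets

_≟ˢ_ : ∀ {n} (p q : Subset n) → Dec (p ≡ q)
_≟ˢ_ = Vecₚ.≡-dec Boolₚ._≟_

⊆-or-witness : ∀ {n} (p q : Subset n) → p ⊆ q ⊎ ∃ λ x → x ∈ p × x ∉ q
⊆-or-witness p q with Finₚ.any? (λ x → x ∈? p ×-dec ¬? (x ∈? q))
... | yes w = inj₂ w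
... | no ¬w = inj₁ λ {x} x∈p → decidable-stable (x ∈? q) (λ x∉q → ¬w (x , x∈p , x∉q))

⊆∧∣q∣≤∣p∣⇒p≡q : ∀ {n} {p q : Subset n} → p ⊆ q → ∣ q ∣ ≤ ∣ p ∣ → p ≡ q
⊆∧∣q∣≤∣p∣⇒p≡q {p = p} {q} p⊆q ∣q∣≤∣p∣ with ⊆-or-witness q p
... | inj₁ q⊆p = ⊆-antisym p⊆q q⊆p
... | inj₂ (x , x∈q , x∉p) = ⊥-elim (ℕₚ.<⇒≱ (p⊂q⇒∣p∣<∣q∣ (p⊆q , x , x∈q , x∉p)) ∣q∣≤∣p∣)

⊆∧∣p∣≡∣q∣⇒p≡q : ∀ {n} {p q : Subset n} → p ⊆ q → ∣ p ∣ ≡ ∣ q ∣ → p ≡ q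
⊆∧∣p∣≡∣q∣⇒p≡q p⊆q eq = ⊆∧∣q∣≤∣p∣⇒p≡q p⊆q (ℕₚ.≤-reflexive (sym eq))

≢∧∣p∣≡∣q∣⇒⊈ : ∀ {n} {p q : Subset n} → p ≢ q → ∣ p ∣ ≡ ∣ q ∣ → ∃ λ x → x ∈ p × x ∉ q
≢∧∣p∣≡∣q∣⇒⊈ {p = p} {q} p≢q ∣p∣≡∣q∣ with ⊆-or-witness p q
... | inj₁ p⊆q = ⊥-elim (p≢q (⊆∧∣p∣≡∣q∣⇒p≡q p⊆q ∣p∣≡∣q∣))
... | inj₂ w = w

0<∣p∣⇒Nonempty : ∀ {n} (p : Subset n) → 0 < ∣ p ∣ → Nonempty p
0<∣p∣⇒Nonempty {n} p 0<∣p∣ with nonempty? p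
... | yes ne = ne
... | no ¬ne = ⊥-elim (ℕₚ.<⇒≢ 0<∣p∣ (sym (trans (cong ∣_∣ (Empty-unique ¬ne)) (∣⊥∣≡0 n))))

x∈p⇒⁅x⁆⊆p : ∀ {n} {p : Subset n} {x} → x ∈ p → ⁅ x ⁆ ⊆ p
x∈p⇒⁅x⁆⊆p {p = p} {x} x∈p y∈⁅x⁆ = subst (_∈ p) (sym (x∈⁅y⁆⇒x≡y x y∈⁅x⁆)) x∈p

x∈p-y⇒x∈p×x≢y : ∀ {n} {p : Subset n} {x y} → x ∈ p - y → x ∈ p × x ≢ y
x∈p-y⇒x∈p×x≢y {p = _ ∷ p} {x = zero}  {y = zero}  ()
x∈p-y⇒x∈p×x≢y {p = _ ∷ p} {x = zero}  {y = suc y} here         = here , λ ()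
x∈p-y⇒x∈p×x≢y {p = _ ∷ p} {x = suc x} {y = zero}  (there x∈p-y) =
  there (subst (x ∈_) (p─⊥≡p p) x∈p-y) , λ ()
x∈p-y⇒x∈p×x≢y {p = _ ∷ p} {x = suc x} {y = suc y} (there x∈p-y) =
  let x∈p , x≢y = x∈p-y⇒x∈p×x≢y x∈p-y in there x∈p , x≢y ∘ Finₚ.suc-injective

x∈p⇒∣p-x∣+1≡∣p∣ : ∀ {n} {p : Subset n} {x} → x ∈ p → suc ∣ p - x ∣ ≡ ∣ p ∣
x∈p⇒∣p-x∣+1≡∣p∣ {p = inside  ∷ p} here       = cong (suc ∘ ∣_∣) (p─⊥≡p p)
x∈p⇒∣p-x∣+1≡∣p∣ {p = inside  ∷ p} (there x∈p) = cong suc (x∈p⇒∣p-x∣+1≡∣p∣ x∈p)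
x∈p⇒∣p-x∣+1≡∣p∣ {p = outside ∷ p} (there x∈p) = x∈p⇒∣p-x∣+1≡∣p∣ x∈p

x∉p⇒∣p∪⁅x⁆∣≡1+∣p∣ : ∀ {n} {p : Subset n} {x} → x ∉ p → ∣ p ∪ ⁅ x ⁆ ∣ ≡ suc ∣ p ∣
x∉p⇒∣p∪⁅x⁆∣≡1+∣p∣ {p = inside  ∷ p} {zero} x∉p = ⊥-elim (x∉p here)
x∉p⇒∣p∪⁅x⁆∣≡1+∣p∣ {p = outside ∷ p} {zero} x∉p = cong (suc ∘ ∣_∣) (∪-identityʳ p)
x∉p⇒∣p∪⁅x⁆∣≡1+∣p∣ {p = inside  ∷ p} {suc x} x∉p = cong suc (x∉p⇒∣p∪⁅x⁆∣≡1+∣p∣ (x∉p ∘ there))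
x∉p⇒∣p∪⁅x⁆∣≡1+∣p∣ {p = outside ∷ p} {suc x} x∉p = x∉p⇒∣p∪⁅x⁆∣≡1+∣p∣ (x∉p ∘ there)

x∈p∪⁅x⁆ : ∀ {n} (p : Subset n) (x : Fin n) → x ∈ p ∪ ⁅ x ⁆
x∈p∪⁅x⁆ p x = q⊆p∪q p ⁅ x ⁆ (x∈⁅x⁆ x)

x∈p∪⁅y⁆⁻ : ∀ {n} {p : Subset n} {x y} → x ∈ p ∪ ⁅ y ⁆ → x ∈ p ⊎ x ≡ y
x∈p∪⁅y⁆⁻ {p = p} {y = y} x∈ = map₂ (x∈⁅y⁆⇒x≡y y) (x∈p∪q⁻ p ⁅ y ⁆ x∈)

x∈p∪⁅y⁆∧x≢y⇒x∈p : ∀ {n} {p : Subset n} {x y} → x ∈ p ∪ ⁅ y ⁆ → x ≢ y → x ∈ p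
x∈p∪⁅y⁆∧x≢y⇒x∈p x∈ x≢y = [ (λ x∈p → x∈p) , ⊥-elim ∘ x≢y ]′ (x∈p∪⁅y⁆⁻ x∈)

∣p∪q∣+∣p∩q∣≡∣p∣+∣q∣ : ∀ {n} (p q : Subset n) → ∣ p ∪ q ∣ + ∣ p ∩ q ∣ ≡ ∣ p ∣ + ∣ q ∣
∣p∪q∣+∣p∩q∣≡∣p∣+∣q∣ []            []            = refl
∣p∪q∣+∣p∩q∣≡∣p∣+∣q∣ (inside  ∷ p) (inside  ∷ q) =
  cong suc (trans (ℕₚ.+-suc _ _) (trans (cong suc (∣p∪q∣+∣p∩q∣≡∣p∣+∣q∣ p q)) (sym (ℕₚ.+-suc _ _))))
∣p∪q∣+∣p∩q∣≡∣p∣+∣q∣ (inside  ∷ p) (outside ∷ q) = cong suc (∣p∪q∣+∣p∩q∣≡∣p∣+∣q∣ p q)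
∣p∪q∣+∣p∩q∣≡∣p∣+∣q∣ (outside ∷ p) (inside  ∷ q) =
  trans (cong suc (∣p∪q∣+∣p∩q∣≡∣p∣+∣q∣ p q)) (sym (ℕₚ.+-suc _ _))
∣p∪q∣+∣p∩q∣≡∣p∣+∣q∣ (outside ∷ p) (outside ∷ q) = ∣p∪q∣+∣p∩q∣≡∣p∣+∣q∣ p q

∪-least : ∀ {n} {p q r : Subset n} → p ⊆ r → q ⊆ r → p ∪ q ⊆ r
∪-least {p = p} {q} p⊆r q⊆r x∈p∪q = [ p⊆r , q⊆r ]′ (x∈p∪q⁻ p q x∈p∪q)

p∪⁅x⁆⊆p∪q : ∀ {n} {p q : Subset n} {x} → x ∈ q → p ∪ ⁅ x ⁆ ⊆ p ∪ q
p∪⁅x⁆⊆p∪q {p = p} {q} x∈q = ∪-least (p⊆p∪q q) (x∈p⇒⁅x⁆⊆p (q⊆p∪q p q x∈q))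

⊆-interpolate-by : ∀ {n} d {s t : Subset n} → s ⊆ t → d + ∣ s ∣ ≤ ∣ t ∣ →
                   ∃ λ u → s ⊆ u × u ⊆ t × ∣ u ∣ ≡ d + ∣ s ∣
⊆-interpolate-by zero    s⊆t _ = _ , (λ x∈s → x∈s) , s⊆t , refl
⊆-interpolate-by (suc d) {s} {t} s⊆t d+1+∣s∣≤∣t∣ with ⊆-or-witness t s
... | inj₁ t⊆s =
  ⊥-elim (ℕₚ.<⇒≱ (ℕₚ.≤-trans (s≤s (ℕₚ.m≤n+m _ d)) d+1+∣s∣≤∣t∣) (p⊆q⇒∣p∣≤∣q∣ t⊆s))
... | inj₂ (x , x∈t , x∉s) =
  let u , s∪x⊆u , u⊆t , ∣u∣≡ = ⊆-interpolate-by d (∪-least s⊆t (x∈p⇒⁅x⁆⊆p x∈t))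
                                  (subst (_≤ ∣ t ∣) (sym card) d+1+∣s∣≤∣t∣)
  in u , s∪x⊆u ∘ p⊆p∪q ⁅ x ⁆ , u⊆t , trans ∣u∣≡ card
  where
  card : d + ∣ s ∪ ⁅ x ⁆ ∣ ≡ suc d + ∣ s ∣
  card = trans (cong (d +_) (x∉p⇒∣p∪⁅x⁆∣≡1+∣p∣ x∉s)) (ℕₚ.+-suc d _)

⊆-interpolate : ∀ {n m} {s t : Subset n} → s ⊆ t → ∣ s ∣ ≤ m → m ≤ ∣ t ∣ →
                ∃ λ u → s ⊆ u × u ⊆ t × ∣ u ∣ ≡ m
⊆-interpolate {m = m} {s} s⊆t ∣s∣≤m m≤∣t∣ =
  let u , s⊆u , u⊆t , ∣u∣≡ = ⊆-interpolate-by (m ∸ ∣ s ∣) s⊆t (subst (_≤ _) (sym eq) m≤∣t∣)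
  in u , s⊆u , u⊆t , trans ∣u∣≡ eq
  where eq = ℕₚ.m∸n+n≡m ∣s∣≤m

∣p∣≤∣q∣-by-injection : ∀ {n} {p q : Subset n} (R : Fin n → Fin n → Set) →
  (∀ {x} → x ∈ p → ∃ λ y → y ∈ q × R x y) →
  (∀ {x x′ y} → x ∈ p → x′ ∈ p → R x y → R x′ y → x ≡ x′) →
  ∣ p ∣ ≤ ∣ q ∣
∣p∣≤∣q∣-by-injection R = go _ refl
  where
  go : ∀ c {p q} → ∣ p ∣ ≡ c →
       (∀ {x} → x ∈ p → ∃ λ y → y ∈ q × R x y) →
       (∀ {x x′ y} → x ∈ p → x′ ∈ p → R x y → R x′ y → x ≡ x′) →
       ∣ p ∣ ≤ ∣ q ∣
  go zero    {q = q} ∣p∣≡0 _ _ = subst (_≤ ∣ q ∣) (sym ∣p∣≡0) z≤n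
  go (suc c) {p} {q} ∣p∣≡1+c f f-inj =
    subst₂ _≤_ (x∈p⇒∣p-x∣+1≡∣p∣ x₀∈p) (x∈p⇒∣p-x∣+1≡∣p∣ y₀∈q) (s≤s (go c ∣p-x₀∣≡c f′ f′-inj))
    where
    nonempty = 0<∣p∣⇒Nonempty p (subst (0 <_) (sym ∣p∣≡1+c) (s≤s z≤n))
    x₀ = proj₁ nonempty
    x₀∈p = proj₂ nonempty
    y₀ = proj₁ (f x₀∈p)
    y₀∈q = proj₁ (proj₂ (f x₀∈p))
    Rx₀y₀ = proj₂ (proj₂ (f x₀∈p))
    ∣p-x₀∣≡c : ∣ p - x₀ ∣ ≡ c
    ∣p-x₀∣≡c = ℕₚ.suc-injective (trans (x∈p⇒∣p-x∣+1≡∣p∣ x₀∈p) ∣p∣≡1+c)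
    f′ : ∀ {x} → x ∈ p - x₀ → ∃ λ y → y ∈ q - y₀ × R x y
    f′ {x} x∈ =
      let x∈p , x≢x₀ = x∈p-y⇒x∈p×x≢y x∈
          y , y∈q , Rxy = f x∈p
          y≢y₀ y≡y₀ = x≢x₀ (f-inj x∈p x₀∈p Rxy (subst (R x₀) (sym y≡y₀) Rx₀y₀))
      in y , x∈p∧x≢y⇒x∈p-y y∈q y≢y₀ , Rxy
    f′-inj : ∀ {x₁ x₂ y} → x₁ ∈ p - x₀ → x₂ ∈ p - x₀ → R x₁ y → R x₂ y → x₁ ≡ x₂
    f′-inj x₁∈ x₂∈ = f-inj (proj₁ (x∈p-y⇒x∈p×x≢y x₁∈)) (proj₁ (x∈p-y⇒x∈p×x≢y x₂∈))

2≤∣p∣⇒distinct-pair : ∀ {n} (p : Subset n) → 2 ≤ ∣ p ∣ → ∃₂ λ x y → x ∈ p × y ∈ p × x ≢ y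
2≤∣p∣⇒distinct-pair p 2≤∣p∣ =
  let x , x∈p = 0<∣p∣⇒Nonempty p (ℕₚ.≤-trans (s≤s z≤n) 2≤∣p∣)
      y , y∈p-x = 0<∣p∣⇒Nonempty (p - x)
                    (ℕₚ.≤-pred (subst (2 ≤_) (sym (x∈p⇒∣p-x∣+1≡∣p∣ x∈p)) 2≤∣p∣))
      y∈p , y≢x = x∈p-y⇒x∈p×x≢y y∈p-x
  in x , y , x∈p , y∈p , y≢x ∘ sym

module _ {n} {K A C : Subset n} (K⊆A : K ⊆ A) (K⊆C : K ⊆ C)
         (∣A∣≡1+∣K∣ : ∣ A ∣ ≡ suc ∣ K ∣) (∣C∣≡1+∣K∣ : ∣ C ∣ ≡ suc ∣ K ∣) (A≢C : A ≢ C) where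

  supersets-apart-outside-core : ∀ {z} → z ∈ C → z ∉ K → z ∉ A
  supersets-apart-outside-core {z} z∈C z∉K z∈A =
    A≢C (trans (sym (K∪z≡ K⊆A z∈A ∣A∣≡1+∣K∣)) (K∪z≡ K⊆C z∈C ∣C∣≡1+∣K∣))
    where
    K∪z≡ : ∀ {D} → K ⊆ D → z ∈ D → ∣ D ∣ ≡ suc ∣ K ∣ → K ∪ ⁅ z ⁆ ≡ D
    K∪z≡ K⊆D z∈D ∣D∣≡ = ⊆∧∣p∣≡∣q∣⇒p≡q (∪-least K⊆D (x∈p⇒⁅x⁆⊆p z∈D))
                                     (trans (x∉p⇒∣p∪⁅x⁆∣≡1+∣p∣ z∉K) (sym ∣D∣≡))

  supersets-meet-in-core : A ∩ C ≡ K
  supersets-meet-in-core = ⊆-antisym A∩C⊆K (λ z∈K → x∈p∩q⁺ (K⊆A z∈K , K⊆C z∈K))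
    where
    A∩C⊆K : A ∩ C ⊆ K
    A∩C⊆K {z} z∈A∩C with z ∈? K
    ... | yes z∈K = z∈K
    ... | no z∉K = let z∈A , z∈C = x∈p∩q⁻ A C z∈A∩C
                   in ⊥-elim (supersets-apart-outside-core z∈C z∉K z∈A)

p∪⁅x⁆∩p∪⁅y⁆≡p : ∀ {n} (p : Subset n) {x y} → x ≢ y → (p ∪ ⁅ x ⁆) ∩ (p ∪ ⁅ y ⁆) ≡ p
p∪⁅x⁆∩p∪⁅y⁆≡p p {x} {y} x≢y = ⊆-antisym ⊆p (λ i∈p → x∈p∩q⁺ (p⊆p∪q ⁅ x ⁆ i∈p , p⊆p∪q ⁅ y ⁆ i∈p))
  where
  ⊆p : (p ∪ ⁅ x ⁆) ∩ (p ∪ ⁅ y ⁆) ⊆ p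
  ⊆p i∈ with x∈p∩q⁻ (p ∪ ⁅ x ⁆) (p ∪ ⁅ y ⁆) i∈
  ... | i∈p∪x , i∈p∪y with x∈p∪⁅y⁆⁻ i∈p∪x | x∈p∪⁅y⁆⁻ i∈p∪y
  ...   | inj₁ i∈p | _        = i∈p
  ...   | inj₂ _   | inj₁ i∈p = i∈p
  ...   | inj₂ i≡x | inj₂ i≡y = ⊥-elim (x≢y (trans (sym i≡x) i≡y))

∣p∣+a≤n⇒a≤∣∁p∣ : ∀ {n a} (p : Subset n) → ∣ p ∣ + a ≤ n → a ≤ ∣ ∁ p ∣
∣p∣+a≤n⇒a≤∣∁p∣ {n} {a} p ∣p∣+a≤n = subst (_≤ ∣ ∁ p ∣) (ℕₚ.m+n∸m≡n ∣ p ∣ a)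
  (subst (∣ p ∣ + a ∸ ∣ p ∣ ≤_) (sym (∣∁p∣≡n∸∣p∣ p)) (ℕₚ.∸-monoˡ-≤ ∣ p ∣ ∣p∣+a≤n))

two-outside : ∀ {n} (p : Subset n) → ∣ p ∣ + 2 ≤ n → ∃₂ λ x y → x ∉ p × y ∉ p × x ≢ y
two-outside p ∣p∣+2≤n =
  let x , y , x∈∁p , y∈∁p , x≢y = 2≤∣p∣⇒distinct-pair (∁ p) (∣p∣+a≤n⇒a≤∣∁p∣ p ∣p∣+2≤n)
  in x , y , x∈∁p⇒x∉p x∈∁p , x∈∁p⇒x∉p y∈∁p , x≢y

-- Automorphisms of Kneser graphs are induced by permutations

⟦_⟧ : ∀ {n k} → KVertex n k → Subset n
⟦_⟧ = proj₁

_#_ : ∀ {n k} → KVertex n k → KVertex n k → Set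
u # v = Disjoint ⟦ u ⟧ ⟦ v ⟧

KVertex-≡ : ∀ {n k} {u v : KVertex n k} → ⟦ u ⟧ ≡ ⟦ v ⟧ → u ≡ v
KVertex-≡ {u = s , p} {v = .s , q} refl = cong (s ,_) (ℕₚ.≡-irrelevant p q)

vertex-through-avoiding : ∀ {n k} {c : Fin n} (P : Subset n) → 1 ≤ k → ∣ P ∣ + k ≤ n → c ∉ P →
                          ∃ λ (Y : KVertex n k) → c ∈ ⟦ Y ⟧ × Disjoint ⟦ Y ⟧ P
vertex-through-avoiding {n} {k} {c} P 1≤k ∣P∣+k≤n c∉P =
  let Y , c∈Y , Y⊆∁P , ∣Y∣≡k = ⊆-interpolate (x∈p⇒⁅x⁆⊆p (x∉p⇒x∈∁p c∉P))
                                 (subst (_≤ k) (sym (∣⁅x⁆∣≡1 c)) 1≤k) (∣p∣+a≤n⇒a≤∣∁p∣ P ∣P∣+k≤n)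
  in (Y , ∣Y∣≡k) , c∈Y (x∈⁅x⁆ c) , λ i i∈Y → x∈∁p⇒x∉p (Y⊆∁P i∈Y)

fixes-all-vertices⇒id : ∀ {n k} → 1 ≤ k → suc k ≤ n → (f : Fin n → Fin n) →
                        (∀ (K : KVertex n k) j → j ∈ ⟦ K ⟧ → f j ∈ ⟦ K ⟧) → ∀ j → f j ≡ j
fixes-all-vertices⇒id {n} {k} 1≤k 1+k≤n f f-fixes j with f j Finₚ.≟ j
... | yes fj≡j = fj≡j
... | no fj≢j =
  let K , j∈K , K#fj = vertex-through-avoiding ⁅ f j ⁆ 1≤k
                         (subst (λ i → i + k ≤ n) (sym (∣⁅x⁆∣≡1 (f j))) 1+k≤n)
                         (fj≢j ∘ sym ∘ x∈⁅y⁆⇒x≡y (f j))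
  in ⊥-elim (K#fj (f j) (f-fixes K j j∈K) (x∈⁅x⁆ (f j)))

record Aut (n k : ℕ) : Set where
  field
    to from      : KVertex n k → KVertex n k
    from∘to      : ∀ u → from (to u) ≡ u
    to∘from      : ∀ v → to (from v) ≡ v
    to-#         : ∀ u v → u # v → to u # to v
    to-#⁻        : ∀ u v → to u # to v → u # v

Aut-inverse : ∀ {n k} → Aut n k → Aut n k
Aut-inverse F = record
  { to = from ; from = to ; from∘to = to∘from ; to∘from = from∘to
  ; to-# = λ u v u#v → to-#⁻ (from u) (from v) (subst₂ _#_ (sym (to∘from u)) (sym (to∘from v)) u#v)
  ; to-#⁻ = λ u v fu#fv → subst₂ _#_ (to∘from u) (to∘from v) (to-# (from u) (from v) fu#fv)
  }
  where open Aut F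

Aut-to-injective : ∀ {n k} (F : Aut n k) {u v} → ⟦ Aut.to F u ⟧ ≡ ⟦ Aut.to F v ⟧ → ⟦ u ⟧ ≡ ⟦ v ⟧
Aut-to-injective F {u} {v} Fu≡Fv = cong ⟦_⟧ (begin
  u                 ≡⟨ from∘to u ⟨
  from (to u)       ≡⟨ cong from (KVertex-≡ Fu≡Fv) ⟩
  from (to v)       ≡⟨ from∘to v ⟩
  v                 ∎)
  where open Aut F; open ≡-Reasoning

Automorphism⇒Aut : ∀ {n k} → Automorphism (Kneser n k) → Aut n k
Automorphism⇒Aut f = record
  { to = to ; from = from ; from∘to = from∘to ; to∘from = to∘from
  ; to-# = λ u v → Equivalence.to (Automorphism.preserve f u v)
  ; to-#⁻ = λ u v → Equivalence.from (Automorphism.preserve f u v)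
  }
  where
  open Bijection (Automorphism.bij f) using (to; surjective; injective)
  from = proj₁ ∘ surjective
  to∘from : ∀ v → to (from v) ≡ v
  to∘from v = proj₂ (surjective v) refl
  from∘to : ∀ u → from (to u) ≡ u
  from∘to u = injective (to∘from (to u))

Induces : ∀ {n k} → Aut n k → (Fin n → Fin n) → Set
Induces {n} {k} F ρ =
  ∀ (X : KVertex n k) j → (j ∈ ⟦ Aut.to F X ⟧ → ρ j ∈ ⟦ X ⟧) × (ρ j ∈ ⟦ X ⟧ → j ∈ ⟦ Aut.to F X ⟧)

module _ {n} (F : Aut n 1) where
  open Aut F

  private
    point : Fin n → KVertex n 1
    point j = ⁅ j ⁆ , ∣⁅x⁆∣≡1 j

    singleton : ∀ (X : KVertex n 1) {i} → i ∈ ⟦ X ⟧ → X ≡ point i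
    singleton X {i} i∈X =
      KVertex-≡ (sym (⊆∧∣p∣≡∣q∣⇒p≡q (x∈p⇒⁅x⁆⊆p i∈X) (trans (∣⁅x⁆∣≡1 i) (sym (proj₂ X)))))

    elementOf : ∀ (X : KVertex n 1) → Nonempty ⟦ X ⟧
    elementOf X = 0<∣p∣⇒Nonempty ⟦ X ⟧ (subst (0 <_) (sym (proj₂ X)) (s≤s z≤n))

  aut-induced₁ : ∃ (Induces F)
  aut-induced₁ = ρ , λ X j → ⇒ X j , ⇐ X j
    where
    ρ : Fin n → Fin n
    ρ j = proj₁ (elementOf (from (point j)))
    ρj∈ : ∀ j → ρ j ∈ ⟦ from (point j) ⟧
    ρj∈ j = proj₂ (elementOf (from (point j)))
    ⇒ : ∀ X j → j ∈ ⟦ to X ⟧ → ρ j ∈ ⟦ X ⟧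
    ⇒ X j j∈ = subst (λ v → ρ j ∈ ⟦ v ⟧)
                     (trans (cong from (sym (singleton (to X) j∈))) (from∘to X)) (ρj∈ j)
    ⇐ : ∀ X j → ρ j ∈ ⟦ X ⟧ → j ∈ ⟦ to X ⟧
    ⇐ X j ρj∈X = subst (λ v → j ∈ ⟦ v ⟧) (sym (trans (cong to X≡) (to∘from (point j)))) (x∈⁅x⁆ j)
      where X≡ = trans (singleton X ρj∈X) (sym (singleton (from (point j)) (ρj∈ j)))

module InductionStep (n k′ : ℕ) (large : suc (suc k′) + suc (suc k′) < n) where

  k m : ℕ
  k = suc k′
  m = suc k

  Vertex : Set
  Vertex = KVertex n m

  N∩N⊆N : Vertex → Vertex → Vertex → Set
  N∩N⊆N A B C = ∀ Y → Y # A → Y # B → Y # C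

  ⊆∪⇒N∩N⊆N : ∀ {A B C} → ⟦ C ⟧ ⊆ ⟦ A ⟧ ∪ ⟦ B ⟧ → N∩N⊆N A B C
  ⊆∪⇒N∩N⊆N {A} {B} C⊆A∪B Y Y#A Y#B i i∈Y i∈C =
    [ Y#A i i∈Y , Y#B i i∈Y ]′ (x∈p∪q⁻ ⟦ A ⟧ ⟦ B ⟧ (C⊆A∪B i∈C))

  N∩N⊆N⇒⊆∪ : ∀ {A B C} → ∣ ⟦ A ⟧ ∪ ⟦ B ⟧ ∣ + m ≤ n → N∩N⊆N A B C → ⟦ C ⟧ ⊆ ⟦ A ⟧ ∪ ⟦ B ⟧
  N∩N⊆N⇒⊆∪ {A} {B} {C} small ABC {c} c∈C with c ∈? ⟦ A ⟧ ∪ ⟦ B ⟧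
  ... | yes c∈A∪B = c∈A∪B
  ... | no c∉A∪B = ⊥-elim (ABC Y Y#A Y#B c c∈Y c∈C)
    where
    avoiding = vertex-through-avoiding (⟦ A ⟧ ∪ ⟦ B ⟧) (s≤s z≤n) small c∉A∪B
    Y = proj₁ avoiding
    c∈Y = proj₁ (proj₂ avoiding)
    Y#A : Y # A
    Y#A i i∈Y = proj₂ (proj₂ avoiding) i i∈Y ∘ p⊆p∪q ⟦ B ⟧
    Y#B : Y # B
    Y#B i i∈Y = proj₂ (proj₂ avoiding) i i∈Y ∘ q⊆p∪q ⟦ A ⟧ ⟦ B ⟧

  record Close (A B : Vertex) : Set where
    constructor close
    field ∣A∩B∣≡k : ∣ ⟦ A ⟧ ∩ ⟦ B ⟧ ∣ ≡ k

  private
    ∣A∣+∣B∣≡ : ∀ (A B : Vertex) → ∣ ⟦ A ⟧ ∣ + ∣ ⟦ B ⟧ ∣ ≡ suc m + k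
    ∣A∣+∣B∣≡ A B = trans (cong₂ _+_ (proj₂ A) (proj₂ B)) (cong suc (ℕₚ.+-suc k k))

  Close⇒∣A∪B∣≡1+m : ∀ {A B} → Close A B → ∣ ⟦ A ⟧ ∪ ⟦ B ⟧ ∣ ≡ suc m
  Close⇒∣A∪B∣≡1+m {A} {B} (close ∣A∩B∣≡k) = ℕₚ.+-cancelʳ-≡ k _ _ (begin
    ∣ ⟦ A ⟧ ∪ ⟦ B ⟧ ∣ + k                    ≡⟨ cong (∣ ⟦ A ⟧ ∪ ⟦ B ⟧ ∣ +_) (sym ∣A∩B∣≡k) ⟩
    ∣ ⟦ A ⟧ ∪ ⟦ B ⟧ ∣ + ∣ ⟦ A ⟧ ∩ ⟦ B ⟧ ∣    ≡⟨ ∣p∪q∣+∣p∩q∣≡∣p∣+∣q∣ ⟦ A ⟧ ⟦ B ⟧ ⟩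
    ∣ ⟦ A ⟧ ∣ + ∣ ⟦ B ⟧ ∣                    ≡⟨ ∣A∣+∣B∣≡ A B ⟩
    suc m + k                                ∎)
    where open ≡-Reasoning

  ∣A∪B∣≡1+m⇒Close : ∀ {A B} → ∣ ⟦ A ⟧ ∪ ⟦ B ⟧ ∣ ≡ suc m → Close A B
  ∣A∪B∣≡1+m⇒Close {A} {B} ∣A∪B∣≡ = close (ℕₚ.+-cancelˡ-≡ (suc m) _ _ (begin
    suc m + ∣ ⟦ A ⟧ ∩ ⟦ B ⟧ ∣                ≡⟨ cong (_+ ∣ ⟦ A ⟧ ∩ ⟦ B ⟧ ∣) (sym ∣A∪B∣≡) ⟩
    ∣ ⟦ A ⟧ ∪ ⟦ B ⟧ ∣ + ∣ ⟦ A ⟧ ∩ ⟦ B ⟧ ∣    ≡⟨ ∣p∪q∣+∣p∩q∣≡∣p∣+∣q∣ ⟦ A ⟧ ⟦ B ⟧ ⟩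
    ∣ ⟦ A ⟧ ∣ + ∣ ⟦ B ⟧ ∣                    ≡⟨ ∣A∣+∣B∣≡ A B ⟩
    suc m + k                                ∎))
    where open ≡-Reasoning

  Close⇒small : ∀ {A B} → Close A B → ∣ ⟦ A ⟧ ∪ ⟦ B ⟧ ∣ + m ≤ n
  Close⇒small AB = subst (λ z → z + m ≤ n) (sym (Close⇒∣A∪B∣≡1+m AB)) large

  ∣A∪⁅z⁆∣≡1+m : ∀ {A : Vertex} {z} → z ∉ ⟦ A ⟧ → ∣ ⟦ A ⟧ ∪ ⁅ z ⁆ ∣ ≡ suc m
  ∣A∪⁅z⁆∣≡1+m {A} z∉A = trans (x∉p⇒∣p∪⁅x⁆∣≡1+∣p∣ z∉A) (cong suc (proj₂ A))

  -- Closeness described through adjacency alone, hence invariant under automorphisms.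
  GraphClose : Vertex → Vertex → Set
  GraphClose A B = ⟦ A ⟧ ≢ ⟦ B ⟧ × (∀ C → ⟦ C ⟧ ≢ ⟦ A ⟧ → N∩N⊆N A B C → N∩N⊆N A C B)

  -- N(A) ∩ N(B) ⊆ N(C) says C ⊆ A ∪ B, and for close A, B the set A ∪ B has only one point
  -- outside A: so any C ≠ A below A ∪ B already spans A ∪ C = A ∪ B.
  Close⇒GraphClose : ∀ {A B} → Close A B → GraphClose A B
  Close⇒GraphClose {A} {B} AB = A≢B , B-spanned
    where
    A≢B : ⟦ A ⟧ ≢ ⟦ B ⟧
    A≢B A≡B = ℕₚ.1+n≢n (begin
      suc k                      ≡⟨ sym (proj₂ A) ⟩
      ∣ ⟦ A ⟧ ∣                  ≡⟨ cong ∣_∣ (sym (∩-idem ⟦ A ⟧)) ⟩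
      ∣ ⟦ A ⟧ ∩ ⟦ A ⟧ ∣          ≡⟨ cong (λ B′ → ∣ ⟦ A ⟧ ∩ B′ ∣) A≡B ⟩
      ∣ ⟦ A ⟧ ∩ ⟦ B ⟧ ∣          ≡⟨ Close.∣A∩B∣≡k AB ⟩
      k                          ∎)
      where open ≡-Reasoning
    B-spanned : ∀ C → ⟦ C ⟧ ≢ ⟦ A ⟧ → N∩N⊆N A B C → N∩N⊆N A C B
    B-spanned C C≢A ABC =
      ⊆∪⇒N∩N⊆N {A} {C} {B} (λ i∈B → subst (_ ∈_) A∪B≡A∪C (q⊆p∪q ⟦ A ⟧ ⟦ B ⟧ i∈B))
      where
      A∪C⊆A∪B : ⟦ A ⟧ ∪ ⟦ C ⟧ ⊆ ⟦ A ⟧ ∪ ⟦ B ⟧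
      A∪C⊆A∪B = ∪-least (p⊆p∪q ⟦ B ⟧) (N∩N⊆N⇒⊆∪ {A} {B} {C} (Close⇒small AB) ABC)
      A∪B≡A∪C : ⟦ A ⟧ ∪ ⟦ B ⟧ ≡ ⟦ A ⟧ ∪ ⟦ C ⟧
      A∪B≡A∪C with ≢∧∣p∣≡∣q∣⇒⊈ C≢A (trans (proj₂ C) (sym (proj₂ A)))
      ... | z , z∈C , z∉A = sym (⊆∧∣q∣≤∣p∣⇒p≡q A∪C⊆A∪B (begin
        ∣ ⟦ A ⟧ ∪ ⟦ B ⟧ ∣   ≡⟨ Close⇒∣A∪B∣≡1+m AB ⟩
        suc m               ≡⟨ ∣A∪⁅z⁆∣≡1+m {A} z∉A ⟨
        ∣ ⟦ A ⟧ ∪ ⁅ z ⁆ ∣   ≤⟨ p⊆q⇒∣p∣≤∣q∣ (p∪⁅x⁆⊆p∪q {p = ⟦ A ⟧} z∈C) ⟩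
        ∣ ⟦ A ⟧ ∪ ⟦ C ⟧ ∣   ∎))
        where open ℕₚ.≤-Reasoning

  -- If A, B are not close, take y ∈ B ∖ A and y′ ∈ B ∖ (A ∪ {y}): an m-set C with
  -- y ∈ C ⊆ A ∪ {y} lies below A ∪ B, yet y′ ∉ A ∪ C.
  GraphClose⇒Close : ∀ {A B} → GraphClose A B → Close A B
  GraphClose⇒Close {A} {B} (A≢B , spanned)
    with ≢∧∣p∣≡∣q∣⇒⊈ (A≢B ∘ sym) (trans (proj₂ B) (sym (proj₂ A)))
  ... | y , y∈B , y∉A with ⊆-or-witness ⟦ B ⟧ (⟦ A ⟧ ∪ ⁅ y ⁆)
  ...   | inj₁ B⊆A∪y = ∣A∪B∣≡1+m⇒Close (trans (cong ∣_∣ A∪B≡A∪y) (∣A∪⁅z⁆∣≡1+m {A} y∉A))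
    where
    A∪B≡A∪y : ⟦ A ⟧ ∪ ⟦ B ⟧ ≡ ⟦ A ⟧ ∪ ⁅ y ⁆
    A∪B≡A∪y = ⊆-antisym (∪-least (p⊆p∪q _) B⊆A∪y) (p∪⁅x⁆⊆p∪q y∈B)
  ...   | inj₂ (y′ , y′∈B , y′∉A∪y) = ⊥-elim (y′∉A∪y (A∪C⊆A∪y (B⊆A∪C y′∈B)))
    where
    A∪y = ⟦ A ⟧ ∪ ⁅ y ⁆
    interpolant = ⊆-interpolate (x∈p⇒⁅x⁆⊆p (x∈p∪⁅x⁆ ⟦ A ⟧ y))
                    (ℕₚ.≤-trans (ℕₚ.≤-reflexive (∣⁅x⁆∣≡1 y)) (s≤s z≤n))
                    (ℕₚ.≤-trans (ℕₚ.n≤1+n m) (ℕₚ.≤-reflexive (sym (∣A∪⁅z⁆∣≡1+m {A} y∉A))))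
    C : Vertex
    C = proj₁ interpolant , proj₂ (proj₂ (proj₂ interpolant))
    y∈C : y ∈ ⟦ C ⟧
    y∈C = proj₁ (proj₂ interpolant) (x∈⁅x⁆ y)
    A∪C⊆A∪y : ⟦ A ⟧ ∪ ⟦ C ⟧ ⊆ A∪y
    A∪C⊆A∪y = ∪-least (p⊆p∪q _) (proj₁ (proj₂ (proj₂ interpolant)))
    C⊆A∪B : ⟦ C ⟧ ⊆ ⟦ A ⟧ ∪ ⟦ B ⟧
    C⊆A∪B = ⊆-trans (A∪C⊆A∪y ∘ q⊆p∪q ⟦ A ⟧ ⟦ C ⟧) (p∪⁅x⁆⊆p∪q y∈B)
    small : ∣ ⟦ A ⟧ ∪ ⟦ C ⟧ ∣ + m ≤ n
    small = ℕₚ.≤-trans (ℕₚ.+-monoˡ-≤ m (subst (∣ ⟦ A ⟧ ∪ ⟦ C ⟧ ∣ ≤_) (∣A∪⁅z⁆∣≡1+m {A} y∉A)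
                                               (p⊆q⇒∣p∣≤∣q∣ A∪C⊆A∪y)))
                       large
    B⊆A∪C : ⟦ B ⟧ ⊆ ⟦ A ⟧ ∪ ⟦ C ⟧
    B⊆A∪C = N∩N⊆N⇒⊆∪ {A} {C} {B} small
              (spanned C (λ C≡A → y∉A (subst (y ∈_) C≡A y∈C)) (⊆∪⇒N∩N⊆N {A} {B} {C} C⊆A∪B))

  core⊆⇒Close : ∀ {A B C} → Close A B → ⟦ A ⟧ ∩ ⟦ B ⟧ ⊆ ⟦ C ⟧ → ⟦ C ⟧ ≢ ⟦ A ⟧ → ⟦ C ⟧ ≢ ⟦ B ⟧ →
                Close A C × Close B C × ∃ λ z → z ∈ ⟦ C ⟧ × z ∉ ⟦ A ⟧ ∪ ⟦ B ⟧
  core⊆⇒Close {A} {B} {C} (close ∣K∣≡k) K⊆C C≢A C≢B with ⊆-or-witness ⟦ C ⟧ (⟦ A ⟧ ∩ ⟦ B ⟧)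
  ... | inj₁ C⊆K = ⊥-elim (ℕₚ.1+n≰n (subst₂ _≤_ (proj₂ C) ∣K∣≡k (p⊆q⇒∣p∣≤∣q∣ C⊆K)))
  ... | inj₂ (z , z∈C , z∉K) =
    close (trans (cong ∣_∣ A∩C≡K) ∣K∣≡k) , close (trans (cong ∣_∣ B∩C≡K) ∣K∣≡k) ,
    z , z∈C , λ z∈A∪B → [ z∉A , z∉B ]′ (x∈p∪q⁻ ⟦ A ⟧ ⟦ B ⟧ z∈A∪B)
    where
    K = ⟦ A ⟧ ∩ ⟦ B ⟧
    size : ∀ (D : Vertex) → ∣ ⟦ D ⟧ ∣ ≡ suc ∣ K ∣
    size D = trans (proj₂ D) (cong suc (sym ∣K∣≡k))
    A∩C≡K = supersets-meet-in-core (p∩q⊆p ⟦ A ⟧ ⟦ B ⟧) K⊆C (size A) (size C) (C≢A ∘ sym)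
    B∩C≡K = supersets-meet-in-core (p∩q⊆q ⟦ A ⟧ ⟦ B ⟧) K⊆C (size B) (size C) (C≢B ∘ sym)
    z∉A = supersets-apart-outside-core (p∩q⊆p ⟦ A ⟧ ⟦ B ⟧) K⊆C (size A) (size C) (C≢A ∘ sym) z∈C z∉K
    z∉B = supersets-apart-outside-core (p∩q⊆q ⟦ A ⟧ ⟦ B ⟧) K⊆C (size B) (size C) (C≢B ∘ sym) z∈C z∉K

  Close-triangle⇒core⊆ : ∀ {A B C} → Close A B → Close A C → Close B C →
                         ∀ {z} → z ∈ ⟦ C ⟧ → z ∉ ⟦ A ⟧ ∪ ⟦ B ⟧ → ⟦ A ⟧ ∩ ⟦ B ⟧ ⊆ ⟦ C ⟧
  Close-triangle⇒core⊆ {A} {B} {C} (close ∣A∩B∣≡k) AC BC {z} z∈C z∉A∪B =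
    subst (_⊆ ⟦ C ⟧) C-z≡A∩B (p─q⊆p ⟦ C ⟧ ⁅ z ⁆)
    where
    ∣C-z∣≡k : ∣ ⟦ C ⟧ - z ∣ ≡ k
    ∣C-z∣≡k = ℕₚ.suc-injective (trans (x∈p⇒∣p-x∣+1≡∣p∣ z∈C) (proj₂ C))
    C-z⊆ : ∀ D → Close D C → z ∉ ⟦ D ⟧ → ⟦ C ⟧ - z ⊆ ⟦ D ⟧
    C-z⊆ D (close ∣D∩C∣≡k) z∉D = subst (_⊆ ⟦ D ⟧) D∩C≡C-z (p∩q⊆p ⟦ D ⟧ ⟦ C ⟧)
      where
      D∩C≡C-z : ⟦ D ⟧ ∩ ⟦ C ⟧ ≡ ⟦ C ⟧ - z
      D∩C≡C-z = ⊆∧∣p∣≡∣q∣⇒p≡q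
        (λ i∈D∩C → let i∈D , i∈C = x∈p∩q⁻ ⟦ D ⟧ ⟦ C ⟧ i∈D∩C
                   in x∈p∧x≢y⇒x∈p-y i∈C (λ { refl → z∉D i∈D }))
        (trans ∣D∩C∣≡k (sym ∣C-z∣≡k))
    C-z≡A∩B : ⟦ C ⟧ - z ≡ ⟦ A ⟧ ∩ ⟦ B ⟧
    C-z≡A∩B = ⊆∧∣p∣≡∣q∣⇒p≡q
      (λ i∈ → x∈p∩q⁺ ( C-z⊆ A AC (z∉A∪B ∘ p⊆p∪q ⟦ B ⟧) i∈
                     , C-z⊆ B BC (z∉A∪B ∘ q⊆p∪q ⟦ A ⟧ ⟦ B ⟧) i∈))
      (trans ∣C-z∣≡k (sym ∣A∩B∣≡k))

  k+k+2≤n : k + k + 2 ≤ n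
  k+k+2≤n = ℕₚ.≤-trans (ℕₚ.≤-reflexive (trans (ℕₚ.+-comm (k + k) 2) (cong suc (sym (ℕₚ.+-suc k k)))))
              (ℕₚ.≤-trans (ℕₚ.n≤1+n _) large)

  record Around (K : KVertex n k) : Set where
    field
      left right   : Vertex
      left∩right≡K : ⟦ left ⟧ ∩ ⟦ right ⟧ ≡ ⟦ K ⟧

    Close-left-right : Close left right
    Close-left-right = close (trans (cong ∣_∣ left∩right≡K) (proj₂ K))

  addPoint : (K : KVertex n k) {x : Fin n} → x ∉ ⟦ K ⟧ → Vertex
  addPoint (K , ∣K∣≡k) {x} x∉K = K ∪ ⁅ x ⁆ , trans (x∉p⇒∣p∪⁅x⁆∣≡1+∣p∣ x∉K) (cong suc ∣K∣≡k)

  around : (K : KVertex n k) → Around K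
  around K with two-outside ⟦ K ⟧ (subst (λ i → i + 2 ≤ n) (sym (proj₂ K)) k+2≤n)
    where k+2≤n = ℕₚ.≤-trans (ℕₚ.+-monoˡ-≤ 2 (ℕₚ.m≤m+n k k)) k+k+2≤n
  ... | x , y , x∉K , y∉K , x≢y = record
    { left = addPoint K x∉K ; right = addPoint K y∉K ; left∩right≡K = p∪⁅x⁆∩p∪⁅y⁆≡p ⟦ K ⟧ x≢y }

  module Transport (F : Aut n m) where
    open Aut F

    to-N∩N⊆N : ∀ {A B C} → N∩N⊆N A B C → N∩N⊆N (to A) (to B) (to C)
    to-N∩N⊆N {A} {B} {C} ABC Y Y#FA Y#FB =
      subst (_# to C) (to∘from Y) (to-# (from Y) C (ABC (from Y) (pull Y#FA) (pull Y#FB)))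
      where
      pull : ∀ {D} → Y # to D → from Y # D
      pull {D} Y#FD = to-#⁻ (from Y) D (subst (_# to D) (sym (to∘from Y)) Y#FD)

    to-N∩N⊆N⁻ : ∀ {A B C} → N∩N⊆N (to A) (to B) (to C) → N∩N⊆N A B C
    to-N∩N⊆N⁻ {A} {B} {C} FABC Y Y#A Y#B = to-#⁻ Y C (FABC (to Y) (to-# Y A Y#A) (to-# Y B Y#B))

    to-GraphClose : ∀ {A B} → GraphClose A B → GraphClose (to A) (to B)
    to-GraphClose {A} {B} (A≢B , spanned) = A≢B ∘ Aut-to-injective F , spanned′
      where
      spanned′ : ∀ C′ → ⟦ C′ ⟧ ≢ ⟦ to A ⟧ → N∩N⊆N (to A) (to B) C′ → N∩N⊆N (to A) C′ (to B)
      spanned′ C′ C′≢FA FABC′ = subst (λ D → N∩N⊆N (to A) D (to B)) (to∘from C′)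
        (to-N∩N⊆N {A} {C} {B} (spanned C C≢A (to-N∩N⊆N⁻ {A} {B} {C} FABC)))
        where
        C = from C′
        C≢A : ⟦ C ⟧ ≢ ⟦ A ⟧
        C≢A C≡A = C′≢FA (cong ⟦_⟧ (trans (sym (to∘from C′)) (cong to (KVertex-≡ C≡A))))
        FABC : N∩N⊆N (to A) (to B) (to C)
        FABC = subst (N∩N⊆N (to A) (to B)) (sym (to∘from C′)) FABC′

    to-Close : ∀ {A B} → Close A B → Close (to A) (to B)
    to-Close = GraphClose⇒Close ∘ to-GraphClose ∘ Close⇒GraphClose

    to-core⊆ : ∀ {A B C} → Close A B → ⟦ A ⟧ ∩ ⟦ B ⟧ ⊆ ⟦ C ⟧ → ⟦ to A ⟧ ∩ ⟦ to B ⟧ ⊆ ⟦ to C ⟧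
    to-core⊆ {A} {B} {C} AB K⊆C with ⟦ C ⟧ ≟ˢ ⟦ A ⟧ | ⟦ C ⟧ ≟ˢ ⟦ B ⟧
    ... | yes C≡A | _ = subst (λ D → _ ⊆ ⟦ to D ⟧) (sym (KVertex-≡ C≡A)) (p∩q⊆p ⟦ to A ⟧ ⟦ to B ⟧)
    ... | no _ | yes C≡B = subst (λ D → _ ⊆ ⟦ to D ⟧) (sym (KVertex-≡ C≡B)) (p∩q⊆q ⟦ to A ⟧ ⟦ to B ⟧)
    ... | no C≢A | no C≢B with core⊆⇒Close AB K⊆C C≢A C≢B
    ...   | AC , BC , z , z∈C , z∉A∪B with ⊆-or-witness ⟦ to C ⟧ (⟦ to A ⟧ ∪ ⟦ to B ⟧)
    ...     | inj₁ FC⊆FA∪FB = ⊥-elim (z∉A∪B (N∩N⊆N⇒⊆∪ {A} {B} {C} (Close⇒small AB)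
                               (to-N∩N⊆N⁻ {A} {B} {C} (⊆∪⇒N∩N⊆N {to A} {to B} {to C} FC⊆FA∪FB)) z∈C))
    ...     | inj₂ (z′ , z′∈FC , z′∉FA∪FB) =
      Close-triangle⇒core⊆ (to-Close AB) (to-Close AC) (to-Close BC) z′∈FC z′∉FA∪FB

    induced : KVertex n k → KVertex n k
    induced K = ⟦ to left ⟧ ∩ ⟦ to right ⟧ , Close.∣A∩B∣≡k (to-Close Close-left-right)
      where open Around (around K)

    induced-⊆ : ∀ K (C : Vertex) → ⟦ K ⟧ ⊆ ⟦ C ⟧ → ⟦ induced K ⟧ ⊆ ⟦ to C ⟧
    induced-⊆ K C K⊆C = to-core⊆ Close-left-right (subst (_⊆ ⟦ C ⟧) (sym left∩right≡K) K⊆C)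
      where open Around (around K)

    induced-≡ : ∀ K (P : Around K) → ⟦ induced K ⟧ ≡ ⟦ to (Around.left P) ⟧ ∩ ⟦ to (Around.right P) ⟧
    induced-≡ K P = ⊆∧∣p∣≡∣q∣⇒p≡q
      (λ i∈ → x∈p∩q⁺ (induced-⊆ K left (K⊆ (p∩q⊆p _ _)) i∈ , induced-⊆ K right (K⊆ (p∩q⊆q _ _)) i∈))
      (trans (proj₂ (induced K)) (sym (Close.∣A∩B∣≡k (to-Close Close-left-right))))
      where
      open Around P
      K⊆ : ∀ {D} → ⟦ left ⟧ ∩ ⟦ right ⟧ ⊆ D → ⟦ K ⟧ ⊆ D
      K⊆ {D} ⊆D = subst (_⊆ D) left∩right≡K ⊆D

    induced-# : ∀ K₁ K₂ → K₁ # K₂ → induced K₁ # induced K₂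
    induced-# K₁ K₂ K₁#K₂ i i∈FK₁ i∈FK₂ =
      to-# A B A#B i (induced-⊆ K₁ A (p⊆p∪q ⁅ x ⁆) i∈FK₁) (induced-⊆ K₂ B (p⊆p∪q ⁅ y ⁆) i∈FK₂)
      where
      K₁∪K₂ = ⟦ K₁ ⟧ ∪ ⟦ K₂ ⟧
      ∣K₁∪K₂∣≤k+k : ∣ K₁∪K₂ ∣ ≤ k + k
      ∣K₁∪K₂∣≤k+k = ℕₚ.m+n≤o⇒m≤o ∣ K₁∪K₂ ∣ (ℕₚ.≤-reflexive
        (trans (∣p∪q∣+∣p∩q∣≡∣p∣+∣q∣ ⟦ K₁ ⟧ ⟦ K₂ ⟧) (cong₂ _+_ (proj₂ K₁) (proj₂ K₂))))
      fresh = two-outside K₁∪K₂ (ℕₚ.≤-trans (ℕₚ.+-monoˡ-≤ 2 ∣K₁∪K₂∣≤k+k) k+k+2≤n)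
      x = proj₁ fresh
      y = proj₁ (proj₂ fresh)
      x∉K₁∪K₂ = proj₁ (proj₂ (proj₂ fresh))
      y∉K₁∪K₂ = proj₁ (proj₂ (proj₂ (proj₂ fresh)))
      A = addPoint K₁ (x∉K₁∪K₂ ∘ p⊆p∪q ⟦ K₂ ⟧)
      B = addPoint K₂ (y∉K₁∪K₂ ∘ q⊆p∪q ⟦ K₁ ⟧ ⟦ K₂ ⟧)
      A#B : A # B
      A#B i i∈A i∈B with x∈p∪⁅y⁆⁻ i∈A | x∈p∪⁅y⁆⁻ i∈B
      ... | inj₁ i∈K₁ | inj₁ i∈K₂ = K₁#K₂ i i∈K₁ i∈K₂
      ... | inj₁ i∈K₁ | inj₂ refl = y∉K₁∪K₂ (p⊆p∪q ⟦ K₂ ⟧ i∈K₁)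
      ... | inj₂ refl | inj₁ i∈K₂ = x∉K₁∪K₂ (q⊆p∪q ⟦ K₁ ⟧ ⟦ K₂ ⟧ i∈K₂)
      ... | inj₂ refl | inj₂ i≡y  = proj₂ (proj₂ (proj₂ (proj₂ fresh))) i≡y

  open Transport using (induced; induced-≡; induced-⊆; induced-#)

  induced-inverse : ∀ (F : Aut n m) K → induced (Aut-inverse F) (induced F K) ≡ K
  induced-inverse F K = KVertex-≡ (begin
    ⟦ induced (Aut-inverse F) (induced F K) ⟧  ≡⟨ induced-≡ (Aut-inverse F) (induced F K) image ⟩
    ⟦ from (to left) ⟧ ∩ ⟦ from (to right) ⟧   ≡⟨ cong₂ (λ A B → ⟦ A ⟧ ∩ ⟦ B ⟧)
                                                        (from∘to left) (from∘to right) ⟩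
    ⟦ left ⟧ ∩ ⟦ right ⟧                       ≡⟨ left∩right≡K ⟩
    ⟦ K ⟧                                      ∎)
    where
    open Aut F
    open Around (around K)
    open ≡-Reasoning
    image : Around (induced F K)
    image = record { left = to left ; right = to right ; left∩right≡K = refl }

  inducedAut : Aut n m → Aut n k
  inducedAut F = record
    { to = induced F ; from = induced (Aut-inverse F)
    ; from∘to = induced-inverse F ; to∘from = induced-inverse (Aut-inverse F)
    ; to-# = induced-# F
    ; to-#⁻ = λ u v Fu#Fv → subst₂ _#_ (induced-inverse F u) (induced-inverse F v)
                              (induced-# (Aut-inverse F) (induced F u) (induced F v) Fu#Fv)
    }

  induced⇒to : ∀ (F : Aut n m) (ρ : Fin n → Fin n) → (∀ K j → ρ j ∈ ⟦ K ⟧ → j ∈ ⟦ induced F K ⟧) →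
               ∀ (X : Vertex) j → ρ j ∈ ⟦ X ⟧ → j ∈ ⟦ Aut.to F X ⟧
  induced⇒to F ρ ρ-induced X j ρj∈X =
    let K , ρj∈K , K⊆X , ∣K∣≡k = ⊆-interpolate (x∈p⇒⁅x⁆⊆p ρj∈X)
                                   (ℕₚ.≤-trans (ℕₚ.≤-reflexive (∣⁅x⁆∣≡1 (ρ j))) (s≤s z≤n))
                                   (ℕₚ.≤-trans (ℕₚ.n≤1+n k) (ℕₚ.≤-reflexive (sym (proj₂ X))))
    in induced-⊆ F (K , ∣K∣≡k) X K⊆X (ρ-induced (K , ∣K∣≡k) j (ρj∈K (x∈⁅x⁆ (ρ j))))

  aut-induced-step : (∀ (G : Aut n k) → ∃ (Induces G)) → ∀ (F : Aut n m) → ∃ (Induces F)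
  aut-induced-step IH F = ρ , λ X j → ⇒ X j , induced⇒to F ρ (λ K i → proj₂ (ρ-induces K i)) X j
    where
    1+k≤n : 1 + k ≤ n
    1+k≤n = ℕₚ.≤-trans (ℕₚ.m≤m+n (suc k) (suc k)) (ℕₚ.≤-trans (ℕₚ.n≤1+n _) large)
    G G⁻ : Aut n k
    G = inducedAut F
    G⁻ = inducedAut (Aut-inverse F)
    ρ σ : Fin n → Fin n
    ρ = proj₁ (IH G)
    σ = proj₁ (IH G⁻)
    ρ-induces : Induces G ρ
    ρ-induces = proj₂ (IH G)
    σ-induces : Induces G⁻ σ
    σ-induces = proj₂ (IH G⁻)
    σ∘ρ≡id : ∀ j → σ (ρ j) ≡ j
    σ∘ρ≡id = fixes-all-vertices⇒id (s≤s z≤n) 1+k≤n (σ ∘ ρ) λ K j j∈K →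
      proj₁ (σ-induces K (ρ j))
        (proj₁ (ρ-induces (Aut.to G⁻ K) j) (subst (λ D → j ∈ ⟦ D ⟧) (sym (Aut.to∘from G K)) j∈K))
    ⇒ : ∀ X j → j ∈ ⟦ Aut.to F X ⟧ → ρ j ∈ ⟦ X ⟧
    ⇒ X j j∈FX = subst (λ D → ρ j ∈ ⟦ D ⟧) (Aut.from∘to F X)
      (induced⇒to (Aut-inverse F) σ (λ K i → proj₂ (σ-induces K i)) (Aut.to F X) (ρ j)
        (subst (_∈ ⟦ Aut.to F X ⟧) (sym (σ∘ρ≡id j)) j∈FX))

aut-induced : ∀ k n → suc k + suc k < n → (F : Aut n (suc k)) → ∃ (Induces F)
aut-induced zero      n _     = aut-induced₁
aut-induced (suc k′) n large = InductionStep.aut-induced-step n k′ large (aut-induced k′ n smaller)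
  where
  smaller : suc k′ + suc k′ < n
  smaller = ℕₚ.≤-trans (s≤s (ℕₚ.+-mono-≤ (ℕₚ.n≤1+n (suc k′)) (ℕₚ.n≤1+n (suc k′)))) large

-- Determining sets are the separating families

lookup-≡ : ∀ {n} {p q : Subset n} {x y} → (x ∈ p → y ∈ q) → (y ∈ q → x ∈ p) → lookup p x ≡ lookup q y
lookup-≡ {p = p} {q} {x} {y} x∈p⇒y∈q y∈q⇒x∈p = Boolₚ.⇔→≡ {z = true} (mk⇔
  (λ px → Vecₚ.[]=⇒lookup (x∈p⇒y∈q (Vecₚ.lookup⇒[]= x p px)))
  (λ qy → Vecₚ.[]=⇒lookup (y∈q⇒x∈p (Vecₚ.lookup⇒[]= y q qy))))

lookup-≡⇒∈ : ∀ {n} {p q : Subset n} {x y} → lookup p x ≡ lookup q y → x ∈ p → y ∈ q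
lookup-≡⇒∈ {q = q} {y = y} px≡qy x∈p = Vecₚ.lookup⇒[]= y q (trans (sym px≡qy) (Vecₚ.[]=⇒lookup x∈p))

Agree : ∀ {n} → List (Subset n) → Fin n → Fin n → Set
Agree L x y = All (λ V → lookup V x ≡ lookup V y) L

Agree? : ∀ {n} (L : List (Subset n)) x y → Dec (Agree L x y)
Agree? L x y = All.all? (λ V → lookup V x Boolₚ.≟ lookup V y) L

Agree-sym : ∀ {n} {L : List (Subset n)} {x y} → Agree L x y → Agree L y x
Agree-sym = All.map sym

Agree-trans : ∀ {n} {L : List (Subset n)} {x y z} → Agree L x y → Agree L y z → Agree L x z
Agree-trans x≈y y≈z = All.zipWith (λ (e₁ , e₂) → trans e₁ e₂) (x≈y , y≈z)

Separating : ∀ {n} → List (Subset n) → Set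
Separating {n} L = ∀ (x y : Fin n) → Agree L x y → x ≡ y

module _ {n} (π : Permutation n n) where

  preimage : Subset n → Subset n
  preimage X = tabulate (lookup X ∘ (π ⟨$⟩ʳ_))

  ∈preimage⁺ : ∀ {X j} → π ⟨$⟩ʳ j ∈ X → j ∈ preimage X
  ∈preimage⁺ {X} {j} πj∈X =
    Vecₚ.lookup⇒[]= j _ (trans (Vecₚ.lookup∘tabulate _ j) (Vecₚ.[]=⇒lookup πj∈X))

  ∈preimage⁻ : ∀ {X j} → j ∈ preimage X → π ⟨$⟩ʳ j ∈ X
  ∈preimage⁻ {X} {j} j∈ =
    Vecₚ.lookup⇒[]= _ X (trans (sym (Vecₚ.lookup∘tabulate _ j)) (Vecₚ.[]=⇒lookup j∈))

  ∣preimage∣≤ : ∀ X → ∣ preimage X ∣ ≤ ∣ X ∣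
  ∣preimage∣≤ X = ∣p∣≤∣q∣-by-injection {q = X} (λ j y → π ⟨$⟩ʳ j ≡ y)
    (λ {j} j∈ → π ⟨$⟩ʳ j , ∈preimage⁻ j∈ , refl)
    (λ {x} {x′} _ _ πx≡y πx′≡y → begin
      x                          ≡⟨ inverseˡ π ⟨
      π ⟨$⟩ˡ (π ⟨$⟩ʳ x)          ≡⟨ cong (π ⟨$⟩ˡ_) (trans πx≡y (sym πx′≡y)) ⟩
      π ⟨$⟩ˡ (π ⟨$⟩ʳ x′)         ≡⟨ inverseˡ π ⟩
      x′                         ∎)
    where open ≡-Reasoning

preimage-flip : ∀ {n} (π : Permutation n n) X → preimage (Perm.flip π) (preimage π X) ≡ X
preimage-flip π X = trans
  (Vecₚ.tabulate-cong λ j → trans (Vecₚ.lookup∘tabulate _ (π ⟨$⟩ˡ j)) (cong (lookup X) (inverseʳ π)))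
  (Vecₚ.tabulate∘lookup X)

∣preimage∣≡ : ∀ {n} (π : Permutation n n) X → ∣ preimage π X ∣ ≡ ∣ X ∣
∣preimage∣≡ π X = ℕₚ.≤-antisym (∣preimage∣≤ π X)
  (subst (_≤ ∣ preimage π X ∣) (cong ∣_∣ (preimage-flip π X))
         (∣preimage∣≤ (Perm.flip π) (preimage π X)))

preimage-flip′ : ∀ {n} (π : Permutation n n) X → preimage π (preimage (Perm.flip π) X) ≡ X
preimage-flip′ π = preimage-flip (Perm.flip π)

permutationAut : ∀ {n k} → Permutation n n → Automorphism (Kneser n k)
permutationAut {n} {k} π = record
  { bij      = mk⤖ {to = pre π} (injective , surjective)
  ; preserve = λ u v → mk⇔ (pre-# u v) (pre-#⁻ u v)
  }
  where
  pre : Permutation n n → KVertex n k → KVertex n k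
  pre π (X , ∣X∣≡k) = preimage π X , trans (∣preimage∣≡ π X) ∣X∣≡k
  injective : ∀ {u v} → pre π u ≡ pre π v → u ≡ v
  injective {u} {v} πu≡πv = KVertex-≡ (begin
    ⟦ u ⟧                                   ≡⟨ preimage-flip π ⟦ u ⟧ ⟨
    preimage (Perm.flip π) ⟦ pre π u ⟧      ≡⟨ cong (preimage (Perm.flip π) ∘ ⟦_⟧) πu≡πv ⟩
    preimage (Perm.flip π) ⟦ pre π v ⟧      ≡⟨ preimage-flip π ⟦ v ⟧ ⟩
    ⟦ v ⟧                                   ∎)
    where open ≡-Reasoning
  surjective : ∀ v → ∃ λ u → ∀ {w} → w ≡ u → pre π w ≡ v
  surjective v = pre (Perm.flip π) v , λ { refl → KVertex-≡ (preimage-flip′ π ⟦ v ⟧) }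
  pre-# : ∀ u v → u # v → pre π u # pre π v
  pre-# u v u#v i i∈u i∈v = u#v (π ⟨$⟩ʳ i) (∈preimage⁻ π i∈u) (∈preimage⁻ π i∈v)
  pre-#⁻ : ∀ u v → pre π u # pre π v → u # v
  pre-#⁻ u v πu#πv i i∈u i∈v = πu#πv (π ⟨$⟩ˡ i) (back {u} i∈u) (back {v} i∈v)
    where
    back : ∀ {w} → i ∈ ⟦ w ⟧ → π ⟨$⟩ˡ i ∈ ⟦ pre π w ⟧
    back {w} i∈w = ∈preimage⁺ π (subst (_∈ ⟦ w ⟧) (sym (inverseʳ π)) i∈w)

module _ {n} (a b : Fin n) where

  private
    τ : Permutation n n
    τ = Perm.transpose a b

  transpose-preserves : ∀ (V : Subset n) → lookup V a ≡ lookup V b → preimage τ V ≡ V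
  transpose-preserves V Va≡Vb = trans (Vecₚ.tabulate-cong swap) (Vecₚ.tabulate∘lookup V)
    where
    swap : ∀ j → lookup V (τ ⟨$⟩ʳ j) ≡ lookup V j
    swap j with j Finₚ.≟ a
    ... | yes refl = sym Va≡Vb
    ... | no _ with j Finₚ.≟ b
    ...   | yes refl = Va≡Vb
    ...   | no _ = refl

  transpose-b : a ≢ b → τ ⟨$⟩ʳ b ≡ a
  transpose-b a≢b with b Finₚ.≟ a
  ... | yes b≡a = ⊥-elim (a≢b (sym b≡a))
  ... | no _ with b Finₚ.≟ b
  ...   | yes _ = refl
  ...   | no b≢b = ⊥-elim (b≢b refl)

-- Two points that no member of S separates can be swapped without moving any member of S.
Determining⇒Separating : ∀ {n k} → 1 ≤ k → suc k ≤ n → (S : List (KVertex n k)) →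
                         IsDetermining (Kneser n k) S → Separating (map ⟦_⟧ S)
Determining⇒Separating {n} {k} 1≤k 1+k≤n S determining a b a≈b with a Finₚ.≟ b
... | yes a≡b = a≡b
... | no a≢b = ⊥-elim (X#b b (subst (λ w → b ∈ ⟦ w ⟧) (determining τ τ-fixes-S X) b∈τX) (x∈⁅x⁆ b))
  where
  τ : Automorphism (Kneser n k)
  τ = permutationAut (Perm.transpose a b)
  τ-fixes-S : ∀ v → v Listₘ.∈ S → autFun τ v ≡ v
  τ-fixes-S v v∈S = KVertex-≡ (transpose-preserves a b ⟦ v ⟧ (All.lookup (Allₚ.map⁻ a≈b) v∈S))
  avoiding = vertex-through-avoiding ⁅ b ⁆ 1≤k (subst (λ i → i + k ≤ n) (sym (∣⁅x⁆∣≡1 b)) 1+k≤n)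
                                     (a≢b ∘ x∈⁅y⁆⇒x≡y b)
  X = proj₁ avoiding
  X#b = proj₂ (proj₂ avoiding)
  b∈τX : b ∈ ⟦ autFun τ X ⟧
  b∈τX = ∈preimage⁺ (Perm.transpose a b)
           (subst (_∈ ⟦ X ⟧) (sym (transpose-b a b a≢b)) (proj₁ (proj₂ avoiding)))

Separating⇒Determining : ∀ {n k} → 1 ≤ k → 2 * k < n → (S : List (KVertex n k)) →
                         Separating (map ⟦_⟧ S) → IsDetermining (Kneser n k) S
Separating⇒Determining {n} {suc k} (s≤s z≤n) 2k<n S separating f f-fixes v = KVertex-≡ (⊆-antisym
  (λ {j} j∈fv → subst (_∈ ⟦ v ⟧) (ρ≡id j) (proj₁ (ρ-induces v j) j∈fv))
  (λ {j} j∈v → proj₂ (ρ-induces v j) (subst (_∈ ⟦ v ⟧) (sym (ρ≡id j)) j∈v)))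
  where
  large : suc k + suc k < n
  large = subst (λ i → suc k + i < n) (ℕₚ.+-identityʳ (suc k)) 2k<n
  induced = aut-induced k n large (Automorphism⇒Aut f)
  ρ = proj₁ induced
  ρ-induces = proj₂ induced
  ρ≡id : ∀ j → ρ j ≡ j
  ρ≡id j = sym (separating j (ρ j) (Allₚ.map⁺ (All.tabulate λ {w} w∈S →
    lookup-≡ (λ j∈w → proj₁ (ρ-induces w j) (subst (λ u → j ∈ ⟦ u ⟧) (sym (f-fixes w w∈S)) j∈w))
             (λ ρj∈w → subst (λ u → j ∈ ⟦ u ⟧) (f-fixes w w∈S) (proj₂ (ρ-induces w j) ρj∈w)))))

-- From n to n + 1 points

embed : ∀ {n k} → KVertex n k → KVertex (suc n) k
embed (V , ∣V∣≡k) = outside ∷ V , ∣V∣≡k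

adjoin-separating : ∀ {n k} → 1 ≤ k → 2 ≤ n → (S : List (KVertex n k)) → Separating (map ⟦_⟧ S) →
                    ∃ λ (S′ : List (KVertex (suc n) k)) →
                      Separating (map ⟦_⟧ S′) × length S′ ≡ suc (length S)
adjoin-separating _ (s≤s (s≤s _)) [] separating with separating zero (suc zero) []
... | ()
adjoin-separating {n} {suc k} _ _ (V ∷ S) separating =
  W ∷ map embed (V ∷ S) , separating′ , cong suc (length-map embed (V ∷ S))
  where
  interpolant = ⊆-interpolate {m = k} (⊆-min ⟦ V ⟧) (subst (_≤ k) (sym (∣⊥∣≡0 n)) z≤n)
                  (ℕₚ.≤-trans (ℕₚ.n≤1+n k) (ℕₚ.≤-reflexive (sym (proj₂ V))))
  W₀ = proj₁ interpolant
  W₀⊆V : W₀ ⊆ ⟦ V ⟧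
  W₀⊆V = proj₁ (proj₂ (proj₂ interpolant))
  W : KVertex (suc n) (suc k)
  W = inside ∷ W₀ , cong suc (proj₂ (proj₂ (proj₂ interpolant)))
  new≉old : ∀ b → ¬ Agree (map ⟦_⟧ (W ∷ map embed (V ∷ S))) zero (suc b)
  new≉old b (true≡W₀b ∷ false≡Vb ∷ _) with
    trans false≡Vb (Vecₚ.[]=⇒lookup (W₀⊆V (Vecₚ.lookup⇒[]= b W₀ (sym true≡W₀b))))
  ... | ()
  separating′ : Separating (map ⟦_⟧ (W ∷ map embed (V ∷ S)))
  separating′ zero    zero    _            = refl
  separating′ (suc a) (suc b) (_ ∷ a≈b)    =
    cong suc (separating a b (Allₚ.map⁺ (Allₚ.map⁻ {xs = V ∷ S} (Allₚ.map⁻ a≈b))))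
  separating′ zero    (suc b) a≈b          = ⊥-elim (new≉old b a≈b)
  separating′ (suc a) zero    a≈b          = ⊥-elim (new≉old a (All.map sym a≈b))

module _ {n} (D R : List (Subset n)) {V : Subset n} (∣V∣<∣∁V∣ : ∣ V ∣ < ∣ ∁ V ∣)
         (separating : Separating (D ++ V ∷ R)) where

  private
    Agree-split : ∀ {U x y} → Agree (D ++ U ∷ R) x y →
                  Agree (D ++ R) x y × lookup U x ≡ lookup U y
    Agree-split x≈y with Allₚ.++⁻ D x≈y
    ... | on-D , on-U ∷ on-R = Allₚ.++⁺ on-D on-R , on-U

    Agree-join : ∀ {U x y} → Agree (D ++ R) x y → lookup U x ≡ lookup U y →
                 Agree (D ++ U ∷ R) x y
    Agree-join x≈y on-U with Allₚ.++⁻ D x≈y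
    ... | on-D , on-R = Allₚ.++⁺ on-D (on-U ∷ on-R)

    Partner : Fin n → Set
    Partner x = ∃ λ b → b ∈ V × Agree (D ++ R) x b

    partner? : ∀ x → Dec (Partner x)
    partner? x = Finₚ.any? λ b → b ∈? V ×-dec Agree? (D ++ R) x b

    -- Separation makes a point outside V determined by its partner in V.
    unpartnered : ∃ λ x → x ∉ V × ¬ Partner x
    unpartnered with Finₚ.any? (λ x → ¬? (x ∈? V) ×-dec ¬? (partner? x))
    ... | yes found = found
    ... | no none =
      ⊥-elim (ℕₚ.<⇒≱ ∣V∣<∣∁V∣ (∣p∣≤∣q∣-by-injection (Agree (D ++ R)) partner partner-injective))
      where
      partner : ∀ {x} → x ∈ ∁ V → Partner x
      partner {x} x∈∁V = decidable-stable (partner? x) λ ¬p → none (x , x∈∁p⇒x∉p x∈∁V , ¬p)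
      partner-injective : ∀ {x x′ b} → x ∈ ∁ V → x′ ∈ ∁ V →
                          Agree (D ++ R) x b → Agree (D ++ R) x′ b → x ≡ x′
      partner-injective {x} {x′} x∈∁V x′∈∁V x≈b x′≈b = separating x x′
        (Agree-join (Agree-trans x≈b (Agree-sym x′≈b))
                    (lookup-≡ (⊥-elim ∘ x∈∁p⇒x∉p x∈∁V) (⊥-elim ∘ x∈∁p⇒x∉p x′∈∁V)))

  enlarge-separating : ∃ λ x → x ∉ V × Separating (D ++ (V ∪ ⁅ x ⁆) ∷ R)
  enlarge-separating = x , x∉V , separating′
    where
    x = proj₁ unpartnered
    x∉V = proj₁ (proj₂ unpartnered)
    no-partner = proj₂ (proj₂ unpartnered)
    V∪x-at : ∀ {i} → i ≢ x → lookup (V ∪ ⁅ x ⁆) i ≡ lookup V i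
    V∪x-at i≢x = lookup-≡ (λ i∈ → x∈p∪⁅y⁆∧x≢y⇒x∈p i∈ i≢x) (p⊆p∪q {p = V} ⁅ x ⁆)
    partner-from : ∀ {j} → j ≢ x → lookup (V ∪ ⁅ x ⁆) x ≡ lookup (V ∪ ⁅ x ⁆) j →
                   ¬ Agree (D ++ R) x j
    partner-from {j} j≢x x≈j-on-V∪x x≈j =
      no-partner (j , x∈p∪⁅y⁆∧x≢y⇒x∈p (lookup-≡⇒∈ x≈j-on-V∪x (x∈p∪⁅x⁆ V x)) j≢x , x≈j)
    separating′ : Separating (D ++ (V ∪ ⁅ x ⁆) ∷ R)
    separating′ i j i≈j with Agree-split i≈j | i Finₚ.≟ x | j Finₚ.≟ x
    ... | _ | yes refl | yes refl = refl
    ... | off , on | yes refl | no j≢x = ⊥-elim (partner-from j≢x on off)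
    ... | off , on | no i≢x | yes refl = ⊥-elim (partner-from i≢x (sym on) (Agree-sym off))
    ... | off , on | no i≢x | no j≢x =
      separating i j (Agree-join off (trans (sym (V∪x-at i≢x)) (trans on (V∪x-at j≢x))))

complete-separating : ∀ {n k} → k + k ≤ n → (D R : List (Subset n)) (V : Subset n) →
                      ∣ V ∣ ≡ k ⊎ suc ∣ V ∣ ≡ k →
                      Separating (D ++ V ∷ R) → ∃ λ (V′ : KVertex n k) → Separating (D ++ ⟦ V′ ⟧ ∷ R)
complete-separating _ D R V (inj₁ ∣V∣≡k) separating = (V , ∣V∣≡k) , separating
complete-separating {n} {k} k+k≤n D R V (inj₂ 1+∣V∣≡k) separating =
  let x , x∉V , separating′ = enlarge-separating D R ∣V∣<∣∁V∣ separating
  in (V ∪ ⁅ x ⁆ , trans (x∉p⇒∣p∪⁅x⁆∣≡1+∣p∣ x∉V) 1+∣V∣≡k) , separating′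
  where
  ∣V∣<∣∁V∣ : ∣ V ∣ < ∣ ∁ V ∣
  ∣V∣<∣∁V∣ = ∣p∣+a≤n⇒a≤∣∁p∣ V (ℕₚ.≤-trans (ℕₚ.+-monoˡ-≤ (suc ∣ V ∣) (ℕₚ.n≤1+n ∣ V ∣))
                                  (subst (λ i → i + i ≤ n) (sym 1+∣V∣≡k) k+k≤n))

complete-all-separating : ∀ {n k} → k + k ≤ n → (D R : List (Subset n)) →
  All (λ V → ∣ V ∣ ≡ k ⊎ suc ∣ V ∣ ≡ k) R → Separating (D ++ R) →
  ∃ λ (S : List (KVertex n k)) → Separating (D ++ map ⟦_⟧ S) × length S ≡ length R
complete-all-separating _ D [] [] separating = [] , separating , refl
complete-all-separating k+k≤n D (V ∷ R) (size ∷ sizes) separating =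
  let V′ , separating′ = complete-separating k+k≤n D R V size separating
      S , separating″ , length-S = complete-all-separating k+k≤n (D ++ [ ⟦ V′ ⟧ ]) R sizes
                                     (subst Separating (sym (++-assoc D [ ⟦ V′ ⟧ ] R)) separating′)
  in V′ ∷ S , subst Separating (++-assoc D [ ⟦ V′ ⟧ ] (map ⟦_⟧ S)) separating″ , cong suc length-S

restrict : ∀ {n k} → KVertex (suc n) k → Subset n
restrict ((_ ∷ V) , _) = V

restrict-size : ∀ {n k} (v : KVertex (suc n) k) → ∣ restrict v ∣ ≡ k ⊎ suc ∣ restrict v ∣ ≡ k
restrict-size ((inside  ∷ V) , ∣v∣≡k) = inj₂ ∣v∣≡k
restrict-size ((outside ∷ V) , ∣v∣≡k) = inj₁ ∣v∣≡k

restrict-separating : ∀ {n k} (S : List (KVertex (suc n) k)) →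
                      Separating (map ⟦_⟧ S) → Separating (map restrict S)
restrict-separating S separating a b a≈b =
  Finₚ.suc-injective
    (separating (suc a) (suc b) (Allₚ.map⁺ (All.map (λ {v} → shift v) (Allₚ.map⁻ a≈b))))
  where
  shift : ∀ v → lookup (restrict v) a ≡ lookup (restrict v) b →
                lookup ⟦ v ⟧ (suc a) ≡ lookup ⟦ v ⟧ (suc b)
  shift ((_ ∷ V) , _) e = e

mainTheorem1 : (n k : ℕ) → 1 ≤ k → 2 * k < n →
    (d d′ : ℕ) → IsDetNumber (Kneser n k) d → IsDetNumber (Kneser (suc n) k) d′ →
    (d ≤ d′) × (d′ ≤ d + 1)
mainTheorem1 n k 1≤k 2k<n d d′ ((S , S-det , ∣S∣≡d) , d-min) ((S′ , S′-det , ∣S′∣≡d′) , d′-min) =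
  d≤d′ , d′≤d+1
  where
  k+k<n : k + k < n
  k+k<n = subst (λ i → k + i < n) (ℕₚ.+-identityʳ k) 2k<n
  1+k≤n : suc k ≤ n
  1+k≤n = ℕₚ.≤-trans (s≤s (ℕₚ.m≤m+n k k)) k+k<n
  S-sep : Separating (map ⟦_⟧ S)
  S-sep = Determining⇒Separating 1≤k 1+k≤n S S-det
  S′-sep : Separating (map ⟦_⟧ S′)
  S′-sep = Determining⇒Separating 1≤k (ℕₚ.m≤n⇒m≤1+n 1+k≤n) S′ S′-det
  d≤d′ : d ≤ d′
  d≤d′ =
    let T , T-sep , ∣T∣≡ = complete-all-separating (ℕₚ.<⇒≤ k+k<n) [] (map restrict S′)
                             (Allₚ.map⁺ (All.universal restrict-size S′)) (restrict-separating S′ S′-sep)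
    in subst (d ≤_) (trans ∣T∣≡ (trans (length-map restrict S′) ∣S′∣≡d′))
             (d-min T (Separating⇒Determining 1≤k 2k<n T T-sep))
  d′≤d+1 : d′ ≤ d + 1
  d′≤d+1 =
    let T , T-sep , ∣T∣≡ = adjoin-separating 1≤k (ℕₚ.≤-trans (s≤s 1≤k) 1+k≤n) S S-sep
    in subst (d′ ≤_) (trans ∣T∣≡ (trans (cong suc ∣S∣≡d) (ℕₚ.+-comm 1 d)))
             (d′-min T (Separating⇒Determining 1≤k (ℕₚ.m≤n⇒m≤1+n 2k<n) T T-sep))
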